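{- Let $d\ge1$, $k_1,\dots,k_d\ge1$, $n=k_1+\dots+k_d$. For $1\le i\le d$ let $C_i=\mathrm{Circ}(c_{i,0},\dots,c_{i,k_i-1})\in\mathbb{C}^{k_i\times k_i}$, and for $i\ne j$ let $a_{i,j}\in\mathbb{C}$. Let $A$ be the $n\times n$ block matrix whose $(i,i)$ block is $C_i$ and whose $(i,j)$ block ($i\ne j$) is the $k_i\times k_j$ matrix with all entries $a_{i,j}$, and let $\overline{A}$ be the $d\times d$ matrix with $\overline{A}_{ii}=\sum_{m=0}^{k_i-1}c_{i,m}$ and $\overline{A}_{ij}=a_{i,j}k_j$ for $i\ne j$. If $v\in\mathbb{C}^d$, $\lambda\in\mathrm{Spec}(\overline{A})$ and $m\in\mathbb{N}$ satisfy $(\overline{A}-\lambda I)^m v=0$, then $(A-\lambda I)^m v^\otimes=0$. That is, tensor expansions of generalized eigenvectors of $\overline{A}$ are generalized eigenvectors of $A$ for the same eigenvalue.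
   Context: $\mathrm{Circ}(c_0,\dots,c_{k-1})$ is the $k\times k$ matrix whose $(r,s)$ entry (indices $0,\dots,k-1$) is $c_{(r-s)\bmod k}$. For $v=(x_1,\dots,x_d)^T\in\mathbb{C}^d$, its tensor expansion is $v^\otimes=(x_1,\dots,x_1,\dots,x_d,\dots,x_d)^T\in\mathbb{C}^n$, where $x_i$ is repeated $k_i$ times. -}

module Defs where

open import Level using (Level)
open import Algebra.Bundles using (CommutativeRing)
open import Data.Nat using (ℕ; zero; suc; _+_; _∸_)
open import Data.Nat.DivMod using (_%_; m%n<n)
open import Data.Fin using (Fin; toℕ; fromℕ<; _≟_)
open import Data.Product using (Σ; _,_)
open import Relation.Nullary using (yes; no)
open import Relation.Binary.PropositionalEquality using (refl)

-- (r - s) mod k as an element of Fin k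
circIdx : {k : ℕ} → Fin k → Fin k → Fin k
circIdx {suc k} r s = fromℕ< (m%n<n ((toℕ r + suc k) ∸ toℕ s) (suc k))

module _ {c ℓ : Level} (R : CommutativeRing c ℓ) where
  open CommutativeRing R
  open import Algebra.Definitions.RawMonoid +-rawMonoid using (sum) renaming (_×_ to _·ℕ_)

  Circ : {k : ℕ} → (Fin k → Carrier) → Fin k → Fin k → Carrier
  Circ cs r s = cs (circIdx r s)

  -- Index set of ℂ^n, n = k_1+…+k_d, in block form: (block i, position within block)
  Blk : {d : ℕ} → (Fin d → ℕ) → Set
  Blk {d} k = Σ (Fin d) (λ i → Fin (k i))

  sumBlk : {d : ℕ} (k : Fin d → ℕ) → (Blk k → Carrier) → Carrier
  sumBlk k f = sum (λ i → sum (λ p → f (i , p)))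

  blockA : {d : ℕ} (k : Fin d → ℕ) (cs : (i : Fin d) → Fin (k i) → Carrier)
           (a : Fin d → Fin d → Carrier) → Blk k → Blk k → Carrier
  blockA k cs a (i , r) (j , s) with i ≟ j
  ... | yes refl = Circ (cs i) r s
  ... | no _ = a i j

  barA : {d : ℕ} (k : Fin d → ℕ) (cs : (i : Fin d) → Fin (k i) → Carrier)
         (a : Fin d → Fin d → Carrier) → Fin d → Fin d → Carrier
  barA k cs a i j with i ≟ j
  ... | yes _ = sum (cs i)
  ... | no _ = k j ·ℕ a i j

  tensorExp : {d : ℕ} (k : Fin d → ℕ) → (Fin d → Carrier) → Blk k → Carrier
  tensorExp k v (i , _) = v i

  module Mat {I : Set} (Σ' : (I → Carrier) → Carrier) where
    shift : ((x y : I) → Carrier) → ((x y : I) → Carrier) → Carrier → I → I → Carrier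
    shift M Id λ' x y = M x y - λ' * Id x y

    mul : (I → I → Carrier) → (I → I → Carrier) → I → I → Carrier
    mul M N x y = Σ' (λ z → M x z * N z y)

    pow : (I → I → Carrier) → (I → I → Carrier) → ℕ → I → I → Carrier
    pow Id M zero = Id
    pow Id M (suc m) = mul M (pow Id M m)

    app : (I → I → Carrier) → (I → Carrier) → I → Carrier
    app M v x = Σ' (λ z → M x z * v z)

  idFin : {d : ℕ} → Fin d → Fin d → Carrier
  idFin i j with i ≟ j
  ... | yes _ = 1#
  ... | no _ = 0#

  idBlk : {d : ℕ} (k : Fin d → ℕ) → Blk k → Blk k → Carrier
  idBlk k (i , r) (j , s) with i ≟ j
  ... | no _ = 0#
  ... | yes refl with r ≟ s
  ...   | yes _ = 1#
  ...   | no _ = 0#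

  genFin : {d : ℕ} → (Fin d → Fin d → Carrier) → Carrier → ℕ → (Fin d → Carrier) → Fin d → Carrier
  genFin {d} M λ' m v = app (pow idFin (shift M idFin λ') m) v
    where open Mat {Fin d} sum

  genBlk : {d : ℕ} (k : Fin d → ℕ) → (Blk k → Blk k → Carrier) → Carrier → ℕ → (Blk k → Carrier) → Blk k → Carrier
  genBlk k M λ' m v = app (pow (idBlk k) (shift M (idBlk k) λ') m) v
    where open Mat {Blk k} (sumBlk k)

  inSpec : {d : ℕ} → (Fin d → Fin d → Carrier) → Carrier → Set (c Level.⊔ ℓ)
  inSpec {d} M λ' = Σ (Fin d → Carrier) (λ w →
      ((∀ i → w i ≈ 0#) → Data.Empty.⊥) Data.Product.× (∀ i → app M w i ≈ λ' * w i))
    where open Mat {Fin d} sum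
          import Data.Empty
          import Data.Product

{-# OPTIONS --safe #-}
module Submission where

-- Say that an n×n matrix P lumps to a d×d matrix Q when
-- every row of every (i, j) block of P sums to Q i j. Lumping is preserved by
-- sums, scalar multiples and products, the identity lumps to the identity, and
-- A lumps to Ā because each row of a circulant block is a permutation of its
-- first column. Hence (A - λI)^m lumps to (Ā - λI)^m, and a matrix that lumps to
-- Q maps the tensor expansion of v to the tensor expansion of Q v.

open import Defs
open import Level using (Level)
open import Algebra.Bundles using (CommutativeRing)
open import Data.Nat using (ℕ; zero; suc; _≤_)
open import Data.Fin using (Fin; zero; suc; _≟_; toℕ)
open import Data.Fin.Properties using (toℕ-fromℕ<; toℕ-injective; toℕ<n)
open import Data.Fin.Permutation using (permutation)
open import Data.Product using (_,_)
open import Data.Empty using (⊥-elim)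
open import Relation.Nullary using (Dec; yes; no)
open import Relation.Binary.PropositionalEquality as ≡ using (_≡_; _≢_)

module CircIdx where
  open import Data.Nat using (_+_; _∸_; _<_)
  open import Data.Nat.Properties as ℕ using (≤-<-connex)
  open import Data.Nat.DivMod using (_%_; m%n<n; m<n⇒m%n≡m; [m+n]%n≡m%n)
  open import Data.Sum using (inj₁; inj₂)

  [a+n∸[a+n∸b]%n]%n≡b : ∀ n {a b} → a < suc n → b < suc n →
                        (a + suc n ∸ (a + suc n ∸ b) % suc n) % suc n ≡ b
  [a+n∸[a+n∸b]%n]%n≡b n {a} {b} a<n b<n with ≤-<-connex b a
  ... | inj₁ b≤a = begin
    (a + N ∸ (a + N ∸ b) % N) % N  ≡⟨ ≡.cong (λ z → (a + N ∸ z % N) % N) (ℕ.+-∸-comm N b≤a) ⟩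
    (a + N ∸ (a ∸ b + N) % N) % N  ≡⟨ ≡.cong (λ z → (a + N ∸ z) % N) ([m+n]%n≡m%n (a ∸ b) N) ⟩
    (a + N ∸ (a ∸ b) % N) % N      ≡⟨ ≡.cong (λ z → (a + N ∸ z) % N) (m<n⇒m%n≡m a∸b<N) ⟩
    (a + N ∸ (a ∸ b)) % N          ≡⟨ ≡.cong (_% N) (ℕ.+-∸-comm N (ℕ.m∸n≤m a b)) ⟩
    (a ∸ (a ∸ b) + N) % N          ≡⟨ ≡.cong (λ z → (z + N) % N) (ℕ.m∸[m∸n]≡n b≤a) ⟩
    (b + N) % N                    ≡⟨ [m+n]%n≡m%n b N ⟩
    b % N                          ≡⟨ m<n⇒m%n≡m b<n ⟩
    b                              ∎
    where
    open ≡.≡-Reasoning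
    N = suc n
    a∸b<N : a ∸ b < N
    a∸b<N = ℕ.≤-<-trans (ℕ.m∸n≤m a b) a<n
  ... | inj₂ a<b = begin
    (a + N ∸ (a + N ∸ b) % N) % N  ≡⟨ ≡.cong (λ z → (a + N ∸ z) % N) (m<n⇒m%n≡m a+N∸b<N) ⟩
    (a + N ∸ (a + N ∸ b)) % N      ≡⟨ ≡.cong (_% N) (ℕ.m∸[m∸n]≡n b≤a+N) ⟩
    b % N                          ≡⟨ m<n⇒m%n≡m b<n ⟩
    b                              ∎
    where
    open ≡.≡-Reasoning
    N = suc n
    b≤a+N : b ≤ a + N
    b≤a+N = ℕ.≤-trans (ℕ.<⇒≤ b<n) (ℕ.m≤n+m N a)
    a+N∸b<N : a + N ∸ b < N
    a+N∸b<N = ≡.subst (a + N ∸ b <_) (ℕ.m+n∸m≡n a N) (ℕ.∸-monoʳ-< a<b b≤a+N)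

  toℕ-circIdx : ∀ {n} (r t : Fin (suc n)) → toℕ (circIdx r t) ≡ (toℕ r + suc n ∸ toℕ t) % suc n
  toℕ-circIdx {n} r t = toℕ-fromℕ< (m%n<n (toℕ r + suc n ∸ toℕ t) (suc n))

  circIdx-involutive : ∀ {k} (r t : Fin k) → circIdx r (circIdx r t) ≡ t
  circIdx-involutive {suc n} r t = toℕ-injective (begin
    toℕ (circIdx r (circIdx r t))                              ≡⟨ toℕ-circIdx r (circIdx r t) ⟩
    (toℕ r + suc n ∸ toℕ (circIdx r t)) % suc n                ≡⟨ ≡.cong (λ z → (toℕ r + suc n ∸ z) % suc n) (toℕ-circIdx r t) ⟩
    (toℕ r + suc n ∸ (toℕ r + suc n ∸ toℕ t) % suc n) % suc n  ≡⟨ [a+n∸[a+n∸b]%n]%n≡b n (toℕ<n r) (toℕ<n t) ⟩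
    toℕ t                                                      ∎)
    where open ≡.≡-Reasoning

open CircIdx using (circIdx-involutive)

module _ {c ℓ : Level} (R : CommutativeRing c ℓ) where
  open CommutativeRing R hiding (zero)
  open import Algebra.Properties.Semiring.Sum semiring
  open import Algebra.Properties.AbelianGroup +-abelianGroup using (⁻¹-∙-comm)
  open import Algebra.Properties.Group +-group using (ε⁻¹≈ε)
  open import Relation.Binary.Reasoning.Setoid setoid

  sum-neg : ∀ {n} (f : Fin n → Carrier) → sum (λ t → - f t) ≈ - sum f
  sum-neg {zero} f = sym ε⁻¹≈ε
  sum-neg {suc n} f = trans (+-congˡ (sum-neg (λ t → f (suc t)))) (⁻¹-∙-comm _ _)

  sum-sub : ∀ {n} (f g : Fin n → Carrier) → sum (λ t → f t - g t) ≈ sum f - sum g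
  sum-sub f g = trans (∑-distrib-+ f (λ t → - g t)) (+-congˡ (sum-neg g))

  sum-idFin-row : ∀ {n} (r : Fin n) → sum (idFin R r) ≈ 1#
  sum-idFin-row {suc n} zero = begin
    1# + sum {n} (λ s → idFin R zero (suc s))  ≈⟨ +-congˡ (sum-cong-≋ {n} (λ _ → refl)) ⟩
    1# + sum {n} (λ _ → 0#)                    ≈⟨ +-congˡ (sum-replicate-zero n) ⟩
    1# + 0#                                    ≈⟨ +-identityʳ 1# ⟩
    1#                                         ∎
  sum-idFin-row {suc n} (suc r) = begin
    0# + sum (λ s → idFin R (suc r) (suc s))  ≈⟨ +-identityˡ _ ⟩
    sum (λ s → idFin R (suc r) (suc s))       ≈⟨ sum-cong-≋ idFin-suc ⟩
    sum (idFin R r)                           ≈⟨ sum-idFin-row r ⟩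
    1#                                        ∎
    where
    idFin-suc : ∀ s → idFin R (suc r) (suc s) ≈ idFin R r s
    idFin-suc s with r ≟ s
    ... | yes _ = refl
    ... | no _  = refl

  idFin-diagonal : ∀ {n} (i : Fin n) → 1# ≈ idFin R i i
  idFin-diagonal i with i ≟ i
  ... | yes _  = refl
  ... | no i≢i = ⊥-elim (i≢i ≡.refl)

  idFin-off-diagonal : ∀ {n} {i j : Fin n} → i ≢ j → 0# ≈ idFin R i j
  idFin-off-diagonal {i = i} {j} i≢j with i ≟ j
  ... | yes i≡j = ⊥-elim (i≢j i≡j)
  ... | no _    = refl

  sum-circIdx : ∀ {n} (f : Fin n → Carrier) (r : Fin n) → sum (λ s → f (circIdx r s)) ≈ sum f
  sum-circIdx f r = sym (sum-permute f (permutation (circIdx r) (circIdx r)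
    (circIdx-involutive r) (circIdx-involutive r)))

  module _ {d : ℕ} (k : Fin d → ℕ) where
    private
      module B = Mat R {Blk R k} (sumBlk R k)
      module F = Mat R {Fin d} sum

    Lumps : (Blk R k → Blk R k → Carrier) → (Fin d → Fin d → Carrier) → Set ℓ
    Lumps P Q = ∀ i r j → sum (λ s → P (i , r) (j , s)) ≈ Q i j

    idBlk-diagonal : ∀ i (r s : Fin (k i)) → idBlk R k (i , r) (i , s) ≈ idFin R r s
    idBlk-diagonal i r s with i ≟ i
    ... | no i≢i = ⊥-elim (i≢i ≡.refl)
    ... | yes ≡.refl with r ≟ s
    ...   | yes _ = refl
    ...   | no _  = refl

    idBlk-lumps : Lumps (idBlk R k) (idFin R)
    idBlk-lumps i r j = row-sum (i ≟ j)
      where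
      row-sum : Dec (i ≡ j) → sum (λ s → idBlk R k (i , r) (j , s)) ≈ idFin R i j
      row-sum (yes ≡.refl) = begin
        sum (λ s → idBlk R k (i , r) (i , s))  ≈⟨ sum-cong-≋ (idBlk-diagonal i r) ⟩
        sum (idFin R r)                        ≈⟨ sum-idFin-row r ⟩
        1#                                     ≈⟨ idFin-diagonal i ⟩
        idFin R i i                            ∎
      row-sum (no i≢j) = begin
        sum (λ s → idBlk R k (i , r) (j , s))  ≈⟨ sum-cong-≋ (λ s → idBlk-off-diagonal s i≢j) ⟩
        sum {k j} (λ _ → 0#)                   ≈⟨ sum-replicate-zero (k j) ⟩
        0#                                     ≈⟨ idFin-off-diagonal i≢j ⟩
        idFin R i j                            ∎
        where
        idBlk-off-diagonal : ∀ s → i ≢ j → idBlk R k (i , r) (j , s) ≈ 0#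
        idBlk-off-diagonal s i≢j with i ≟ j
        ... | yes i≡j = ⊥-elim (i≢j i≡j)
        ... | no _    = refl

    blockA-lumps : ∀ cs a → Lumps (blockA R k cs a) (barA R k cs a)
    blockA-lumps cs a i r j with i ≟ j
    ... | yes ≡.refl = sum-circIdx (cs i) r
    ... | no _       = sum-replicate (k j)

    shift-lumps : ∀ {M Id : Blk R k → Blk R k → Carrier} {N Id′ : Fin d → Fin d → Carrier} λ′ →
                  Lumps M N → Lumps Id Id′ →
                  Lumps (B.shift M Id λ′) (F.shift N Id′ λ′)
    shift-lumps {M} {Id} {N} {Id′} λ′ M⇊N Id⇊Id′ i r j = begin
      sum (λ s → M (i , r) (j , s) - λ′ * Id (i , r) (j , s))
        ≈⟨ sum-sub (λ s → M (i , r) (j , s)) (λ s → λ′ * Id (i , r) (j , s)) ⟩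
      sum (λ s → M (i , r) (j , s)) - sum (λ s → λ′ * Id (i , r) (j , s))
        ≈⟨ +-cong (M⇊N i r j) (-‿cong (sym (*-distribˡ-sum λ′ (λ s → Id (i , r) (j , s))))) ⟩
      N i j - λ′ * sum (λ s → Id (i , r) (j , s))
        ≈⟨ +-congˡ (-‿cong (*-congˡ (Id⇊Id′ i r j))) ⟩
      N i j - λ′ * Id′ i j
        ∎

    mul-lumps : ∀ {P P′ : Blk R k → Blk R k → Carrier} {Q Q′ : Fin d → Fin d → Carrier} →
                Lumps P Q → Lumps P′ Q′ → Lumps (B.mul P P′) (F.mul Q Q′)
    mul-lumps {P} {P′} {Q} {Q′} P⇊Q P′⇊Q′ i r j = begin
      sum (λ s → sum (λ l → sum (λ t → P (i , r) (l , t) * P′ (l , t) (j , s))))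
        ≈⟨ ∑-comm (λ s l → sum (λ t → P (i , r) (l , t) * P′ (l , t) (j , s))) ⟩
      sum (λ l → sum (λ s → sum (λ t → P (i , r) (l , t) * P′ (l , t) (j , s))))
        ≈⟨ sum-cong-≋ (λ l → ∑-comm (λ s t → P (i , r) (l , t) * P′ (l , t) (j , s))) ⟩
      sum (λ l → sum (λ t → sum (λ s → P (i , r) (l , t) * P′ (l , t) (j , s))))
        ≈⟨ sum-cong-≋ (λ l → sum-cong-≋ (λ t → sym (*-distribˡ-sum (P (i , r) (l , t)) (λ s → P′ (l , t) (j , s))))) ⟩
      sum (λ l → sum (λ t → P (i , r) (l , t) * sum (λ s → P′ (l , t) (j , s))))
        ≈⟨ sum-cong-≋ (λ l → sum-cong-≋ (λ t → *-congˡ (P′⇊Q′ l t j))) ⟩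
      sum (λ l → sum (λ t → P (i , r) (l , t) * Q′ l j))
        ≈⟨ sum-cong-≋ (λ l → sym (*-distribʳ-sum (Q′ l j) (λ t → P (i , r) (l , t)))) ⟩
      sum (λ l → sum (λ t → P (i , r) (l , t)) * Q′ l j)
        ≈⟨ sum-cong-≋ (λ l → *-congʳ (P⇊Q i r l)) ⟩
      sum (λ l → Q i l * Q′ l j)
        ∎

    pow-lumps : ∀ {Id M : Blk R k → Blk R k → Carrier} {Id′ N : Fin d → Fin d → Carrier} →
                Lumps Id Id′ → Lumps M N → ∀ m → Lumps (B.pow Id M m) (F.pow Id′ N m)
    pow-lumps Id⇊Id′ M⇊N zero    = Id⇊Id′
    pow-lumps Id⇊Id′ M⇊N (suc m) = mul-lumps M⇊N (pow-lumps Id⇊Id′ M⇊N m)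

    app-tensorExp : ∀ {P : Blk R k → Blk R k → Carrier} {Q : Fin d → Fin d → Carrier} →
                    Lumps P Q → ∀ v i r →
                    B.app P (tensorExp R k v) (i , r) ≈ tensorExp R k (F.app Q v) (i , r)
    app-tensorExp {P} P⇊Q v i r = sum-cong-≋ λ j →
      trans (sym (*-distribʳ-sum (v j) (λ s → P (i , r) (j , s)))) (*-congʳ (P⇊Q i r j))

    genBlk-tensorExp : ∀ {M N} → Lumps M N → ∀ λ′ m v i r →
                       genBlk R k M λ′ m (tensorExp R k v) (i , r) ≈ genFin R N λ′ m v i
    genBlk-tensorExp M⇊N λ′ m v i r =
      app-tensorExp (pow-lumps idBlk-lumps (shift-lumps λ′ M⇊N idBlk-lumps) m) v i r

proposition3p5 : {c ℓ : Level} (R : CommutativeRing c ℓ) → let open CommutativeRing R in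
    (d : ℕ) → 1 ≤ d → (k : Fin d → ℕ) → (∀ i → 1 ≤ k i) →
    (cs : (i : Fin d) → Fin (k i) → Carrier) → (a : Fin d → Fin d → Carrier) →
    (v : Fin d → Carrier) → (λ' : Carrier) → (m : ℕ) →
    inSpec R (barA R k cs a) λ' →
    (∀ i → genFin R (barA R k cs a) λ' m v i ≈ 0#) →
    ∀ x → genBlk R k (blockA R k cs a) λ' m (tensorExp R k v) x ≈ 0#
proposition3p5 R d _ k _ cs a v λ' m _ barA-annihilates-v (i , r) =
  trans (genBlk-tensorExp R k (blockA-lumps R k cs a) λ' m v i r) (barA-annihilates-v i)
  where open CommutativeRing R using (trans)
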